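{- Let $t\ge 2$ and let $2\le p_1\le p_2\le\dots\le p_t$ be integers, and let $n$ be an integer with $n\ge \sum_{i=1}^t p_i+t-3$. Then the graph $H(n;p_1,p_2,\dots,p_t)$ is $K_{p_1}\cup\dots\cup K_{p_t}$-saturated if and only if, for every $2\le i\le t-1$, either $p_{i+1}-p_i\ge p_1$ or $p_{i+1}=p_i$.
   Context: All graphs are finite and simple. $K_m$ denotes the complete graph and $I_m$ the edgeless graph (independent set) on $m$ vertices. For vertex-disjoint graphs $G,H$, $G\cup H$ is their disjoint union and $G\lor H$ (the join) is obtained from $G\cup H$ by adding all edges between $V(G)$ and $V(H)$. For integers $2\le p_1\le\dots\le p_t$, $H(n;p_1,\dots,p_t)$ denotes the $n$-vertex graph $K_{p_1-2}\lor\bigl(K_{p_2+1}\cup\dots\cup K_{p_t+1}\cup I_{n-t+3-\sum_{i=1}^t p_i}\bigr)$. A graph $G$ is $F$-saturated if $G$ contains no subgraph isomorphic to $F$, but for every pair of nonadjacent vertices $u,v$ of $G$, the graph $G+uv$ contains a subgraph isomorphic to $F$. $K_{p_1}\cup\dots\cup K_{p_t}$ denotes the vertex-disjoint union of cliques of orders $p_1,\dots,p_t$. -}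

module Defs where

open import Data.Nat using (ℕ; zero; suc; _+_; _∸_; _<ᵇ_; _≡ᵇ_)
open import Data.Bool using (Bool; true; false; _∧_; _∨_; not; if_then_else_)
open import Data.Fin using (Fin; toℕ; _≟_)
open import Data.List using (List; []; _∷_; map; upTo)
open import Data.Nat.ListAction using (sum)
open import Data.Maybe using (Maybe; just; nothing)
import Data.Maybe as Maybe
open import Data.Product using (Σ; _×_; _,_)
open import Relation.Nullary using (¬_; does)
open import Relation.Binary.PropositionalEquality using (_≡_; _≢_)
open import Function.Definitions using (Injective)

-- A (simple) graph on the vertex set Fin n, given by a Boolean adjacency
-- function.  All concrete graphs below are symmetric and irreflexive.
Graph : ℕ → Set
Graph n = Fin n → Fin n → Bool

Contains : ∀ {m k} → Graph m → Graph k → Set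
Contains {m} {k} F G =
  Σ (Fin m → Fin k) λ f → Injective _≡_ _≡_ f ×
    (∀ u v → F u v ≡ true → G (f u) (f v) ≡ true)

addEdge : ∀ {k} → Graph k → Fin k → Fin k → Graph k
addEdge G u v x y =
  G x y ∨ (does (x ≟ u) ∧ does (y ≟ v)) ∨ (does (x ≟ v) ∧ does (y ≟ u))

Saturated : ∀ {m k} → Graph m → Graph k → Set
Saturated F G =
  ¬ Contains F G ×
  (∀ u v → u ≢ v → G u v ≡ false → Contains F (addEdge G u v))

-- Consecutive blocks of the given sizes partition an initial segment of ℕ;
-- blockOf ss k is the index of the block containing k (nothing if beyond).
blockOf : List ℕ → ℕ → Maybe ℕ
blockOf [] k = nothing
blockOf (s ∷ ss) k =
  if k <ᵇ s then just 0 else Maybe.map suc (blockOf ss (k ∸ s))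

sameBlock : Maybe ℕ → Maybe ℕ → Bool
sameBlock (just a) (just b) = a ≡ᵇ b
sameBlock _ _ = false

unionCliques : (ss : List ℕ) → Graph (sum ss)
unionCliques ss u v =
  not (toℕ u ≡ᵇ toℕ v) ∧ sameBlock (blockOf ss (toℕ u)) (blockOf ss (toℕ v))

-- the list [p 1, …, p t]  (p is 1-indexed; only p 1 … p t matter)
pList : ℕ → (ℕ → ℕ) → List ℕ
pList t p = map (λ i → p (suc i)) (upTo t)

-- H(n; p_1,…,p_t) = K_{p_1-2} ∨ (K_{p_2+1} ∪ … ∪ K_{p_t+1} ∪ I_{rest}) on Fin n:
-- vertices 0 … p_1-3 form the universal clique, then consecutive cliques
-- of orders p_2+1, …, p_t+1, and the remaining vertices are isolated
-- (apart from their edges to the universal clique).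
H : (n t : ℕ) → (ℕ → ℕ) → Graph n
H n t p u v =
  not (toℕ u ≡ᵇ toℕ v) ∧
  ((toℕ u <ᵇ a) ∨ (toℕ v <ᵇ a) ∨
   sameBlock (blockOf hs (toℕ u ∸ a)) (blockOf hs (toℕ v ∸ a)))
  where
  a = p 1 ∸ 2
  hs = map (λ i → suc (p (2 + i))) (upTo (t ∸ 1))

module Submission where

-- Write B₂, …, B_t for the cliques of orders p₂ + 1, …, p_t + 1 joined to K_a (a = p₁ − 2) in H.
-- A clique of order at least a + 2 in H lies in K_a ∪ B_j for a single block, so a copy of
-- F = K_{p₁} ∪ … ∪ K_{p_t} sends every K_{p_c} into some K_a ∪ B_{h(c)}, whence p_c ≤ a + p_{h(c)} + 1.
-- Under the gap condition this forces p_c ≤ p_{h(c)}, strictly when two cliques share B_{h(c)}, since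
-- together they would need p_c + p₁ > a + p_{h(c)} + 1 vertices.  The orders therefore never decrease
-- along the orbit of clique 1 under h, and the first repetition of this orbit, which must occur among
-- the t indices, would exhibit two cliques sharing a block without a strict increase.
-- Conversely, if p_i < p_{i+1} < p_i + p₁, then K_{p_{i+1}} fits into B_i plus p_{i+1} − p_i − 1
-- universal vertices, K_{p_i} into B_{i+1}, and K_{p₁} into the remaining vertices of K_a and B_{i+1}.
-- Finally the ends u, v of a non-edge lie outside K_a and in different blocks, so in H + uv the
-- clique K_{p₁} is K_a plus u and v, and each K_{p_j} is B_j minus the end it may contain.

open import Defs
open import Data.Bool using (Bool; true; false; not; _∧_; _∨_; T)
open import Data.Bool.Properties using (∨-zeroʳ)
open import Data.Fin using (Fin; toℕ; fromℕ<)
import Data.Fin as Fin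
open import Data.Fin.Properties
  using (toℕ-injective; toℕ-fromℕ<; fromℕ<-toℕ; fromℕ<-cong; toℕ<n; injective⇒≤)
open import Data.List using (List; applyUpTo)
open import Data.List.Properties using (map-upTo)
open import Data.Maybe using (Maybe; just; nothing)
open import Data.Maybe.Properties using (just-injective)
import Data.Maybe as Maybe
open import Data.Nat
open import Data.Nat.ListAction using (sum)
open import Data.Nat.Properties
open import Data.Nat.Tactic.RingSolver using (solve-∀)
open import Data.Product using (∃-syntax; _×_; _,_; proj₁; proj₂)
open import Data.Sum using (_⊎_; inj₁; inj₂; [_,_]′)
import Data.Sum as Sum
open import Data.Unit using (tt)
open import Function using (_∘_)
open import Function.Bundles using (_⇔_; mk⇔)
open import Function.Definitions using (Injective)
open import Relation.Binary.Definitions using (tri<; tri≈; tri>)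
open import Relation.Binary.PropositionalEquality
open import Relation.Nullary using (¬_; Dec; yes; no; contradiction)
open import Relation.Nullary.Decidable using (dec-true; dec-false; _×-dec_)
open import Relation.Nullary.Reflects using (ofʸ; ofⁿ)

<⇒<ᵇ≡true : ∀ {m n} → m < n → (m <ᵇ n) ≡ true
<⇒<ᵇ≡true {m} {n} = dec-true (m <? n)

≢⇒≡ᵇ≡false : ∀ {m n} → m ≢ n → (m ≡ᵇ n) ≡ false
≢⇒≡ᵇ≡false {m} {n} = dec-false (m ≟ n)

≡ᵇ≡true⇒≡ : ∀ {m n} → (m ≡ᵇ n) ≡ true → m ≡ n
≡ᵇ≡true⇒≡ {m} {n} eq = ≡ᵇ⇒≡ m n (subst T (sym eq) tt)

≡ᵇ≡false⇒≢ : ∀ {m n} → (m ≡ᵇ n) ≡ false → m ≢ n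
≡ᵇ≡false⇒≢ {m} eq refl = subst T eq (≡⇒≡ᵇ m m refl)

sameBlock≡true⇒≡just : ∀ {x y} → sameBlock x y ≡ true → ∃[ c ] x ≡ just c × y ≡ just c
sameBlock≡true⇒≡just {just c} {just d} eq with ≡ᵇ≡true⇒≡ {c} {d} eq
... | refl = c , refl , refl

sameBlock-just : ∀ c → sameBlock (just c) (just c) ≡ true
sameBlock-just c = dec-true (c ≟ c) refl

-- Consecutive blocks of integers

m<n+o∧m≮n⇒m∸n<o : ∀ {m n o} → m < n + o → m ≮ n → m ∸ n < o
m<n+o∧m≮n⇒m∸n<o {n = n} {o} m<n+o m≮n =
  subst (_ <_) (m+n∸m≡n n o) (∸-monoˡ-< m<n+o (≮⇒≥ m≮n))

Within : ℕ → ℕ → ℕ → Set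
Within lo len x = lo ≤ x × x < lo + len

within-+ : ∀ lo {len r} → r < len → Within lo len (lo + r)
within-+ lo r<len = m≤m+n lo _ , +-monoʳ-< lo r<len

within-shiftˡ : ∀ {a lo len x} → a ≤ x → Within lo len (x ∸ a) → Within (a + lo) len x
within-shiftˡ {a} {lo} {len} {x} a≤x (lo≤ , <hi) =
    subst (a + lo ≤_) (m+[n∸m]≡n a≤x) (+-monoʳ-≤ a lo≤)
  , subst₂ _<_ (m+[n∸m]≡n a≤x) (sym (+-assoc a lo len)) (+-monoʳ-< a <hi)

within-shiftʳ : ∀ {a lo len x} → Within (a + lo) len x → a ≤ x × Within lo len (x ∸ a)
within-shiftʳ {a} {lo} {len} {x} (lo≤ , <hi) =
    a≤x
  , subst (_≤ x ∸ a) (m+n∸m≡n a lo) (∸-monoˡ-≤ a lo≤)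
  , subst (x ∸ a <_) (trans (cong (_∸ a) (+-assoc a lo len)) (m+n∸m≡n a _)) (∸-monoˡ-< <hi a≤x)
  where
  a≤x : a ≤ x
  a≤x = ≤-trans (m≤m+n a lo) lo≤

within⇒∸< : ∀ {lo len x} → Within lo len x → x ∸ lo < len
within⇒∸< (lo≤x , x<lo+len) = m<n+o∧m≮n⇒m∸n<o x<lo+len (≤⇒≯ lo≤x)

offset : (ℕ → ℕ) → ℕ → ℕ
offset g c = sum (applyUpTo g c)

InBlock : (ℕ → ℕ) → ℕ → ℕ → Set
InBlock g c = Within (offset g c) (g c)

inBlock⇒blockOf : ∀ g {m c x} → c < m → InBlock g c x → blockOf (applyUpTo g m) x ≡ just c
inBlock⇒blockOf g {suc m} {c} {x} c<m x∈c with x <ᵇ g 0 | <ᵇ-reflects-< x (g 0) | c | x∈c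
... | true  | _         | zero  | _   = refl
... | true  | ofʸ x<g0  | suc _ | lo , _ = contradiction (≤-trans (m≤m+n (g 0) _) lo) (<⇒≱ x<g0)
... | false | ofⁿ x≮g0  | zero  | _ , x<g0 = contradiction x<g0 x≮g0
... | false | _         | suc c | x∈1+c =
  cong (Maybe.map suc) (inBlock⇒blockOf (g ∘ suc) (s<s⁻¹ c<m) (proj₂ (within-shiftʳ x∈1+c)))

blockOf⇒inBlock : ∀ g {m c x} → blockOf (applyUpTo g m) x ≡ just c → c < m × InBlock g c x
blockOf⇒inBlock g {suc m} {c} {x} eq with x <ᵇ g 0 | <ᵇ-reflects-< x (g 0)
blockOf⇒inBlock g {suc m} {.0} {x} refl | true  | ofʸ x<g0 = z<s , z≤n , x<g0
... | false | ofⁿ x≮g0 with blockOf (applyUpTo (g ∘ suc) m) (x ∸ g 0) in eq′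
blockOf⇒inBlock g {suc m} {.(suc c)} {x} refl | false | ofⁿ x≮g0 | just c
  with blockOf⇒inBlock (g ∘ suc) eq′
... | c<m , x∈c = s<s c<m , within-shiftˡ (≮⇒≥ x≮g0) x∈c

blockOf-defined : ∀ g {m x} → x < offset g m → ∃[ c ] blockOf (applyUpTo g m) x ≡ just c
blockOf-defined g {suc m} {x} x<off with x <ᵇ g 0 | <ᵇ-reflects-< x (g 0)
... | true  | _        = 0 , refl
... | false | ofⁿ x≮g0 with blockOf-defined (g ∘ suc) {m} (m<n+o∧m≮n⇒m∸n<o x<off x≮g0)
...   | c , eq = suc c , cong (Maybe.map suc) eq

offset+size≤offset : ∀ g {m c} → c < m → offset g c + g c ≤ offset g m
offset+size≤offset g {suc m} {zero} _ = m≤m+n (g 0) _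
offset+size≤offset g {suc m} {suc c} c<m =
  subst (_≤ g 0 + offset (g ∘ suc) m) (sym (+-assoc (g 0) _ _))
    (+-monoʳ-≤ (g 0) (offset+size≤offset (g ∘ suc) (s<s⁻¹ c<m)))

offset+<offset : ∀ g {m c r} → c < m → r < g c → offset g c + r < offset g m
offset+<offset g {c = c} c<m r<g =
  <-≤-trans (+-monoʳ-< (offset g c) r<g) (offset+size≤offset g c<m)

offset-suc : ∀ g m → offset (suc ∘ g) m ≡ offset g m + m
offset-suc g zero = refl
offset-suc g (suc m) = begin
  suc (g 0 + offset (suc ∘ g ∘ suc) m) ≡⟨ cong (λ z → suc (g 0 + z)) (offset-suc (g ∘ suc) m) ⟩
  suc (g 0 + (offset (g ∘ suc) m + m)) ≡⟨ cong suc (+-assoc (g 0) _ m) ⟨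
  suc (g 0 + offset (g ∘ suc) m + m)   ≡⟨ +-suc _ m ⟨
  g 0 + offset (g ∘ suc) m + suc m     ∎
  where open ≡-Reasoning

-- Maps on initial segments of ℕ

InjectiveOn : ℕ → (ℕ → ℕ) → Set
InjectiveOn q h = ∀ {r s} → r < q → s < q → h r ≡ h s → r ≡ s

injectiveOn⇒≤ : ∀ {q K} (h : ℕ → ℕ) → (∀ {r} → r < q → h r < K) → InjectiveOn q h → q ≤ K
injectiveOn⇒≤ {q} {K} h h<K h-inj = injective⇒≤ {f = f} f-inj
  where
  f : Fin q → Fin K
  f i = fromℕ< (h<K (toℕ<n i))
  f-inj : Injective _≡_ _≡_ f
  f-inj {i} {j} eq = toℕ-injective (h-inj (toℕ<n i) (toℕ<n j)
    (trans (sym (toℕ-fromℕ< _)) (trans (cong toℕ eq) (toℕ-fromℕ< (h<K (toℕ<n j))))))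

injectiveOn-two-intervals⇒≤ : ∀ {q a lo L} (h : ℕ → ℕ) →
                              (∀ {r} → r < q → h r < a ⊎ Within lo L (h r)) →
                              InjectiveOn q h → q ≤ a + L
injectiveOn-two-intervals⇒≤ {q} {a} {lo} {L} h h-into h-inj =
  injectiveOn⇒≤ (compress ∘ h) (compress< ∘ h-into) compress∘h-injective
  where
  compress : ℕ → ℕ
  compress w with w <? a
  ... | yes _ = w
  ... | no  _ = a + (w ∸ lo)

  compress< : ∀ {w} → w < a ⊎ Within lo L w → compress w < a + L
  compress< {w} w∈ with w <? a | w∈
  ... | yes w<a | _ = <-≤-trans w<a (m≤m+n a L)
  ... | no  w≮a | inj₁ w<a = contradiction w<a w≮a
  ... | no  _   | inj₂ (lo≤w , w<lo+L) = +-monoʳ-< a (m<n+o∧m≮n⇒m∸n<o w<lo+L (≤⇒≯ lo≤w))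

  compress∘h-injective : InjectiveOn q (compress ∘ h)
  compress∘h-injective {r} {s} r<q s<q eq with h r <? a | h s <? a | h-into r<q | h-into s<q
  ... | yes _    | yes _    | _                | _                = h-inj r<q s<q eq
  ... | yes hr<a | no  _    | _                | _                = contradiction (subst (_< a) eq hr<a) (m+n≮m a _)
  ... | no  _    | yes hs<a | _                | _                = contradiction (subst (_< a) (sym eq) hs<a) (m+n≮m a _)
  ... | no  hr≮a | _        | inj₁ hr<a        | _                = contradiction hr<a hr≮a
  ... | no  _    | no  hs≮a | _                | inj₁ hs<a        = contradiction hs<a hs≮a
  ... | no  _    | no  _    | inj₂ (lo≤hr , _) | inj₂ (lo≤hs , _) =
    h-inj r<q s<q (∸-cancelʳ-≡ lo≤hr lo≤hs (+-cancelˡ-≡ a _ _ eq))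

append : ℕ → (ℕ → ℕ) → (ℕ → ℕ) → ℕ → ℕ
append q h h′ r with r <? q
... | yes _ = h r
... | no  _ = h′ (r ∸ q)

append-all : ∀ {q q′} (R : ℕ → Set) {h h′} →
             (∀ {r} → r < q → R (h r)) → (∀ {r} → r < q′ → R (h′ r)) →
             ∀ {r} → r < q + q′ → R (append q h h′ r)
append-all {q} R Rh Rh′ {r} r<q+q′ with r <? q
... | yes r<q = Rh r<q
... | no  r≮q = Rh′ (m<n+o∧m≮n⇒m∸n<o r<q+q′ r≮q)

append-injective : ∀ {q q′ h h′} → InjectiveOn q h → InjectiveOn q′ h′ →
                   (∀ {r r′} → r < q → r′ < q′ → h r ≢ h′ r′) →
                   InjectiveOn (q + q′) (append q h h′)
append-injective {q} h-inj h′-inj disjoint {r} {s} r< s< eq with r <? q | s <? q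
... | yes r<q | yes s<q = h-inj r<q s<q eq
... | yes r<q | no  s≮q = contradiction eq (disjoint r<q (m<n+o∧m≮n⇒m∸n<o s< s≮q))
... | no  r≮q | yes s<q = contradiction (sym eq) (disjoint s<q (m<n+o∧m≮n⇒m∸n<o r< r≮q))
... | no  r≮q | no  s≮q =
  ∸-cancelʳ-≡ (≮⇒≥ r≮q) (≮⇒≥ s≮q)
    (h′-inj (m<n+o∧m≮n⇒m∸n<o r< r≮q) (m<n+o∧m≮n⇒m∸n<o s< s≮q) eq)

cutoff : ℕ → ℕ → ℕ → ℕ → ℕ
cutoff b x y w with w <? b
... | yes _ = x
... | no  _ = y

cutoff-< : ∀ {b x y w} → w < b → cutoff b x y w ≡ x
cutoff-< {b} {w = w} w<b with w <? b
... | yes _   = refl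
... | no  w≮b = contradiction w<b w≮b

cutoff-≥ : ∀ {b x y w} → b ≤ w → cutoff b x y w ≡ y
cutoff-≥ {b} {w = w} b≤w with w <? b
... | yes w<b = contradiction w<b (≤⇒≯ b≤w)
... | no  _   = refl

avoid : ℕ → ℕ → ℕ → ℕ
avoid h z r with r ≟ h
... | yes _ = z
... | no  _ = r

avoid≤ : ∀ {h z r} → r < z → avoid h z r ≤ z
avoid≤ {h} {z} {r} r<z with r ≟ h
... | yes _ = ≤-refl
... | no  _ = <⇒≤ r<z

avoid≢ : ∀ {h z r} → r < z → avoid h z r ≢ h
avoid≢ {h} {z} {r} r<z with r ≟ h
... | yes refl = λ z≡r → <-irrefl (sym z≡r) r<z
... | no  r≢h  = r≢h

avoid-injective : ∀ {h z} → InjectiveOn z (avoid h z)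
avoid-injective {h} {z} {r} {s} r<z s<z eq with r ≟ h | s ≟ h
... | yes r≡h | yes s≡h = trans r≡h (sym s≡h)
... | yes _   | no  _   = contradiction s<z (<-irrefl (sym eq))
... | no  _   | yes _   = contradiction r<z (<-irrefl eq)
... | no  _   | no  _   = eq

-- Nondecreasing sequences

≤-from-steps : ∀ (w : ℕ → ℕ) {lo hi} →
               (∀ {j} → lo ≤ j → suc j < hi → w j ≤ w (suc j)) →
               ∀ {i j} → lo ≤ i → i ≤ j → j < hi → w i ≤ w j
≤-from-steps w step {i = i} {j} lo≤i i≤j j<hi with m≤n⇒m<n∨m≡n i≤j
... | inj₂ refl = ≤-refl
≤-from-steps w step {i = i} {suc j} lo≤i _ j<hi | inj₁ i<1+j =
  ≤-trans (≤-from-steps w step lo≤i (s≤s⁻¹ i<1+j) (<-trans (n<1+n j) j<hi))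
          (step (≤-trans lo≤i (s≤s⁻¹ i<1+j)) j<hi)

module _ (w : ℕ → ℕ) (d : ℕ) {lo hi : ℕ}
         (step : ∀ {j} → lo ≤ j → suc j < hi → w (suc j) ≡ w j ⊎ w j + d ≤ w (suc j)) where

  private
    nondecreasing : ∀ {i j} → lo ≤ i → i ≤ j → j < hi → w i ≤ w j
    nondecreasing = ≤-from-steps w λ lo≤j j<hi →
      [ ≤-reflexive ∘ sym , ≤-trans (m≤m+n _ d) ]′ (step lo≤j j<hi)

    ordered-gap : ∀ {i j} → lo ≤ i → i < j → j < hi → w i < w j → w i + d ≤ w j
    ordered-gap {i} {suc j} lo≤i i<1+j j<hi wi<wj
      with m≤n⇒m<n∨m≡n (s≤s⁻¹ i<1+j) | step (≤-trans lo≤i (s≤s⁻¹ i<1+j)) j<hi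
    ... | _         | inj₂ jump =
      ≤-trans (+-monoˡ-≤ d (nondecreasing lo≤i (s≤s⁻¹ i<1+j) (<-trans (n<1+n j) j<hi))) jump
    ... | inj₂ refl | inj₁ same = contradiction (subst (w i <_) same wi<wj) (<-irrefl refl)
    ... | inj₁ i<j  | inj₁ same = subst (w i + d ≤_) (sym same)
      (ordered-gap lo≤i i<j (<-trans (n<1+n j) j<hi) (subst (w i <_) same wi<wj))

  gap-from-steps : ∀ {i j} → lo ≤ i → lo ≤ j → i < hi → j < hi → w i < w j → w i + d ≤ w j
  gap-from-steps {i} {j} lo≤i lo≤j i<hi j<hi wi<wj with <-cmp i j
  ... | tri< i<j _ _ = ordered-gap lo≤i i<j j<hi wi<wj
  ... | tri≈ _ refl _ = contradiction wi<wj (<-irrefl refl)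
  ... | tri> _ _ j<i = contradiction wi<wj (≤⇒≯ (nondecreasing lo≤j (<⇒≤ j<i) i<hi))

tight-collision : ∀ {t} (w f : ℕ → ℕ) → 0 < t → (∀ {c} → c < t → 0 < f c × f c < t) →
                  (∀ {c} → c < t → w c ≤ w (f c)) →
                  ¬ (∀ {c c′} → c < t → c′ < t → 0 < c → c ≢ c′ → f c ≡ f c′ → w c < w (f c))
tight-collision {t} w f 0<t f-into w≤w∘f strict =
  n≮n t (injectiveOn⇒≤ orbit (λ {s} _ → orbit< s) orbit-injective)
  where
  orbit : ℕ → ℕ
  orbit zero    = 0
  orbit (suc s) = f (orbit s)

  orbit< : ∀ s → orbit s < t
  orbit< zero    = 0<t
  orbit< (suc s) = proj₂ (f-into (orbit< s))

  w∘orbit-mono : ∀ {i j} → i ≤ j → w (orbit i) ≤ w (orbit j)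
  w∘orbit-mono {j = j} i≤j =
    ≤-from-steps (w ∘ orbit) (λ {s} _ _ → w≤w∘f (orbit< s)) z≤n i≤j (n<1+n j)

  orbit-distinct : ∀ {i j} → i < j → orbit i ≢ orbit j
  orbit-distinct {zero}  {suc j} _ eq = <-irrefl eq (proj₁ (f-into (orbit< j)))
  orbit-distinct {suc i} {suc j} i<j eq with orbit i ≟ orbit j
  ... | yes same = orbit-distinct (s<s⁻¹ i<j) same
  orbit-distinct {suc i} {suc zero} (s≤s ()) eq | no _
  orbit-distinct {suc i} {suc (suc j)} i<j eq | no differ =
    <-irrefl refl (<-≤-trans
      (strict (orbit< (suc j)) (orbit< i) (proj₁ (f-into (orbit< j))) (differ ∘ sym) (sym eq))
      (≤-trans (≤-reflexive (cong w (sym eq))) (w∘orbit-mono (s<s⁻¹ i<j))))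

  orbit-injective : InjectiveOn (suc t) orbit
  orbit-injective {r} {s} _ _ eq with <-cmp r s
  ... | tri< r<s _ _ = contradiction eq (orbit-distinct r<s)
  ... | tri≈ _ r≡s _ = r≡s
  ... | tri> _ _ s<r = contradiction (sym eq) (orbit-distinct s<r)

-- Packings of cliques

unionCliques-intro : ∀ ss (u v : Fin (sum ss)) → toℕ u ≢ toℕ v →
                     sameBlock (blockOf ss (toℕ u)) (blockOf ss (toℕ v)) ≡ true →
                     unionCliques ss u v ≡ true
unionCliques-intro ss u v u≢v same rewrite ≢⇒≡ᵇ≡false u≢v = same

unionCliques-elim : ∀ ss (u v : Fin (sum ss)) → unionCliques ss u v ≡ true →
                    toℕ u ≢ toℕ v × sameBlock (blockOf ss (toℕ u)) (blockOf ss (toℕ v)) ≡ true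
unionCliques-elim ss u v edge with toℕ u ≡ᵇ toℕ v in eq
... | false = ≡ᵇ≡false⇒≢ eq , edge

addEdge-⊇ : ∀ {k} (G : Graph k) u v {i j} → G i j ≡ true → addEdge G u v i j ≡ true
addEdge-⊇ G u v edge rewrite edge = refl

addEdge-new : ∀ {k} (G : Graph k) u v → addEdge G u v u v ≡ true
addEdge-new G u v rewrite dec-true (u Fin.≟ u) refl | dec-true (v Fin.≟ v) refl = ∨-zeroʳ (G u v)

addEdge-new′ : ∀ {k} (G : Graph k) u v → addEdge G u v v u ≡ true
addEdge-new′ G u v rewrite dec-true (u Fin.≟ u) refl | dec-true (v Fin.≟ v) refl =
  trans (cong (G v u ∨_) (∨-zeroʳ _)) (∨-zeroʳ (G v u))

-- vertex c r is the image of the r-th vertex of the c-th clique K_{s c} of K_{s 0} ∪ … ∪ K_{s (m−1)}.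
record CliquePacking {n} (G : Graph n) (s : ℕ → ℕ) (m : ℕ) : Set where
  field
    vertex           : ℕ → ℕ → ℕ
    vertex<          : ∀ {c r} → c < m → r < s c → vertex c r < n
    vertex-injective : ∀ {c c′ r r′} → c < m → c′ < m → r < s c → r′ < s c′ →
                       vertex c r ≡ vertex c′ r′ → c ≡ c′ × r ≡ r′
    vertex-adjacent  : ∀ {c r r′} (c<m : c < m) (r<s : r < s c) (r′<s : r′ < s c) → r ≢ r′ →
                       G (fromℕ< (vertex< c<m r<s)) (fromℕ< (vertex< c<m r′<s)) ≡ true

module _ {n} {G : Graph n} {s : ℕ → ℕ} {m : ℕ} where

  packing⇒contains : CliquePacking G s m → Contains (unionCliques (applyUpTo s m)) G
  packing⇒contains packing = ψ , ψ-injective , ψ-edge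
    where
    open CliquePacking packing
    N = offset s m

    cliqueOf : Fin N → ℕ
    cliqueOf x = proj₁ (blockOf-defined s {m} (toℕ<n x))

    cliqueOf-blockOf : ∀ x → blockOf (applyUpTo s m) (toℕ x) ≡ just (cliqueOf x)
    cliqueOf-blockOf x = proj₂ (blockOf-defined s {m} (toℕ<n x))

    cliqueOf< : ∀ x → cliqueOf x < m
    cliqueOf< x = proj₁ (blockOf⇒inBlock s {m} (cliqueOf-blockOf x))

    cliqueOf-inBlock : ∀ x → InBlock s (cliqueOf x) (toℕ x)
    cliqueOf-inBlock x = proj₂ (blockOf⇒inBlock s {m} (cliqueOf-blockOf x))

    rankOf : Fin N → ℕ
    rankOf x = toℕ x ∸ offset s (cliqueOf x)

    offset+rankOf : ∀ x → offset s (cliqueOf x) + rankOf x ≡ toℕ x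
    offset+rankOf x = m+[n∸m]≡n (proj₁ (cliqueOf-inBlock x))

    rankOf< : ∀ x → rankOf x < s (cliqueOf x)
    rankOf< x = within⇒∸< (cliqueOf-inBlock x)

    ψ : Fin N → Fin n
    ψ x = fromℕ< (vertex< (cliqueOf< x) (rankOf< x))

    same-position⇒≡ : ∀ {x y} → cliqueOf x ≡ cliqueOf y → rankOf x ≡ rankOf y → x ≡ y
    same-position⇒≡ {x} {y} c≡ r≡ = toℕ-injective (begin
      toℕ x                              ≡⟨ offset+rankOf x ⟨
      offset s (cliqueOf x) + rankOf x   ≡⟨ cong₂ (λ c r → offset s c + r) c≡ r≡ ⟩
      offset s (cliqueOf y) + rankOf y   ≡⟨ offset+rankOf y ⟩
      toℕ y                              ∎)
      where open ≡-Reasoning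

    ψ-injective : Injective _≡_ _≡_ ψ
    ψ-injective {x} {y} eq =
      let (c≡ , r≡) = vertex-injective (cliqueOf< x) (cliqueOf< y) (rankOf< x) (rankOf< y)
                        (trans (sym (toℕ-fromℕ< _)) (trans (cong toℕ eq) (toℕ-fromℕ< _)))
      in same-position⇒≡ c≡ r≡

    adjacent : ∀ {c c′ r r′} (c<m : c < m) (c′<m : c′ < m) (r<s : r < s c) (r′<s : r′ < s c′) →
               c ≡ c′ → (c ≡ c′ → r ≢ r′) →
               G (fromℕ< (vertex< c<m r<s)) (fromℕ< (vertex< c′<m r′<s)) ≡ true
    adjacent c<m _ r<s r′<s refl r≢r′ = vertex-adjacent c<m r<s r′<s (r≢r′ refl)

    ψ-edge : ∀ u v → unionCliques (applyUpTo s m) u v ≡ true → G (ψ u) (ψ v) ≡ true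
    ψ-edge u v edge = adjacent (cliqueOf< u) (cliqueOf< v) (rankOf< u) (rankOf< v) c≡
                        (λ c≡′ r≡ → u≢v (cong toℕ (same-position⇒≡ c≡′ r≡)))
      where
      u≢v = proj₁ (unionCliques-elim (applyUpTo s m) u v edge)
      c≡ : cliqueOf u ≡ cliqueOf v
      c≡ with sameBlock≡true⇒≡just (proj₂ (unionCliques-elim (applyUpTo s m) u v edge))
      ... | _ , bu , bv =
        just-injective (trans (sym (cliqueOf-blockOf u)) (trans bu (trans (sym bv) (cliqueOf-blockOf v))))

  contains⇒packing : Contains (unionCliques (applyUpTo s m)) G → CliquePacking G s m
  contains⇒packing (φ , φ-injective , φ-edge) = record
    { vertex           = vertex
    ; vertex<          = vertex<
    ; vertex-injective = λ c<m c′<m r<s r′<s eq → position-injective c<m c′<m r<s r′<s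
                           (φ-injective (toℕ-injective
                             (trans (sym (vertex-≡ c<m r<s)) (trans eq (vertex-≡ c′<m r′<s)))))
    ; vertex-adjacent  = vertex-adjacent
    }
    where
    N = offset s m

    position : ∀ {c r} → c < m → r < s c → Fin N
    position c<m r<s = fromℕ< (offset+<offset s c<m r<s)

    toℕ-position : ∀ {c r} (c<m : c < m) (r<s : r < s c) → toℕ (position c<m r<s) ≡ offset s c + r
    toℕ-position c<m r<s = toℕ-fromℕ< (offset+<offset s c<m r<s)

    blockOf-position : ∀ {c r} (c<m : c < m) (r<s : r < s c) →
                       blockOf (applyUpTo s m) (toℕ (position c<m r<s)) ≡ just c
    blockOf-position {c} c<m r<s = trans (cong (blockOf (applyUpTo s m)) (toℕ-position c<m r<s))
                                         (inBlock⇒blockOf s c<m (within-+ (offset s c) r<s))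

    position-injective : ∀ {c c′ r r′} (c<m : c < m) (c′<m : c′ < m)
                         (r<s : r < s c) (r′<s : r′ < s c′) →
                         position c<m r<s ≡ position c′<m r′<s → c ≡ c′ × r ≡ r′
    position-injective {c} c<m c′<m r<s r′<s eq
      with just-injective (trans (sym (blockOf-position c<m r<s))
                            (trans (cong (blockOf (applyUpTo s m) ∘ toℕ) eq) (blockOf-position c′<m r′<s)))
    ... | refl = refl , +-cancelˡ-≡ (offset s c) _ _
      (trans (sym (toℕ-position c<m r<s)) (trans (cong toℕ eq) (toℕ-position c′<m r′<s)))

    image : ℕ → ℕ
    image x with x <? N
    ... | yes x<N = toℕ (φ (fromℕ< x<N))
    ... | no  _   = 0

    vertex : ℕ → ℕ → ℕ
    vertex c r = image (offset s c + r)

    vertex-≡ : ∀ {c r} (c<m : c < m) (r<s : r < s c) → vertex c r ≡ toℕ (φ (position c<m r<s))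
    vertex-≡ {c} {r} c<m r<s with offset s c + r <? N
    ... | yes _ = refl
    ... | no  ≮N = contradiction (offset+<offset s c<m r<s) ≮N

    vertex< : ∀ {c r} → c < m → r < s c → vertex c r < n
    vertex< c<m r<s = subst (_< n) (sym (vertex-≡ c<m r<s)) (toℕ<n _)

    fromℕ<-vertex : ∀ {c r} (c<m : c < m) (r<s : r < s c) → fromℕ< (vertex< c<m r<s) ≡ φ (position c<m r<s)
    fromℕ<-vertex c<m r<s = toℕ-injective (trans (toℕ-fromℕ< (vertex< c<m r<s)) (vertex-≡ c<m r<s))

    vertex-adjacent : ∀ {c r r′} (c<m : c < m) (r<s : r < s c) (r′<s : r′ < s c) → r ≢ r′ →
                      G (fromℕ< (vertex< c<m r<s)) (fromℕ< (vertex< c<m r′<s)) ≡ true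
    vertex-adjacent {c} c<m r<s r′<s r≢r′ =
      subst₂ (λ i j → G i j ≡ true) (sym (fromℕ<-vertex c<m r<s)) (sym (fromℕ<-vertex c<m r′<s))
        (φ-edge _ _ (unionCliques-intro (applyUpTo s m) _ _ distinct same-block))
      where
      distinct : toℕ (position c<m r<s) ≢ toℕ (position c<m r′<s)
      distinct eq = r≢r′ (proj₂ (position-injective c<m c<m r<s r′<s (toℕ-injective eq)))
      same-block : sameBlock (blockOf (applyUpTo s m) (toℕ (position c<m r<s)))
                             (blockOf (applyUpTo s m) (toℕ (position c<m r′<s))) ≡ true
      same-block = subst₂ (λ u v → sameBlock u v ≡ true)
                     (sym (blockOf-position c<m r<s)) (sym (blockOf-position c<m r′<s)) (sameBlock-just c)

labelled-injective : ∀ {s : ℕ → ℕ} {m} (vertex : ℕ → ℕ → ℕ) (label : ℕ → ℕ) →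
                     (∀ {c r} → c < m → r < s c → label (vertex c r) ≡ c) →
                     (∀ {c} → c < m → InjectiveOn (s c) (vertex c)) →
                     ∀ {c c′ r r′} → c < m → c′ < m → r < s c → r′ < s c′ →
                     vertex c r ≡ vertex c′ r′ → c ≡ c′ × r ≡ r′
labelled-injective vertex label label-vertex injective c<m c′<m r<s r′<s eq
  with trans (sym (label-vertex c<m r<s)) (trans (cong label eq) (label-vertex c′<m r′<s))
... | refl = refl , injective c<m r<s r′<s eq

-- The join of a clique with a union of cliques

joinAdjacency : ℕ → List ℕ → ℕ → ℕ → Bool
joinAdjacency a hs x y =
  not (x ≡ᵇ y) ∧ ((x <ᵇ a) ∨ (y <ᵇ a) ∨ sameBlock (blockOf hs (x ∸ a)) (blockOf hs (y ∸ a)))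

module Join (a : ℕ) (g : ℕ → ℕ) (m : ℕ) where

  Adjacent : ℕ → ℕ → Set
  Adjacent x y = joinAdjacency a (applyUpTo g m) x y ≡ true

  SameBlock : ℕ → ℕ → Set
  SameBlock x y = sameBlock (blockOf (applyUpTo g m) (x ∸ a)) (blockOf (applyUpTo g m) (y ∸ a)) ≡ true

  adjacent-intro : ∀ {x y} → x ≢ y → x < a ⊎ y < a ⊎ SameBlock x y → Adjacent x y
  adjacent-intro {x} {y} x≢y (inj₁ x<a) rewrite ≢⇒≡ᵇ≡false x≢y | <⇒<ᵇ≡true x<a = refl
  adjacent-intro {x} {y} x≢y (inj₂ (inj₁ y<a))
    rewrite ≢⇒≡ᵇ≡false x≢y | <⇒<ᵇ≡true y<a = ∨-zeroʳ _
  adjacent-intro {x} {y} x≢y (inj₂ (inj₂ same)) rewrite ≢⇒≡ᵇ≡false x≢y | same =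
    trans (cong ((x <ᵇ a) ∨_) (∨-zeroʳ _)) (∨-zeroʳ _)

  adjacent-elim : ∀ {x y} → Adjacent x y → x ≢ y × (x < a ⊎ y < a ⊎ SameBlock x y)
  adjacent-elim {x} {y} adj with x ≡ᵇ y in x≟y | x <ᵇ a | <ᵇ-reflects-< x a | y <ᵇ a | <ᵇ-reflects-< y a
  adjacent-elim () | true | _ | _ | _ | _
  ... | false | true  | ofʸ x<a | _     | _       = ≡ᵇ≡false⇒≢ x≟y , inj₁ x<a
  ... | false | false | _       | true  | ofʸ y<a = ≡ᵇ≡false⇒≢ x≟y , inj₂ (inj₁ y<a)
  ... | false | false | _       | false | _       = ≡ᵇ≡false⇒≢ x≟y , inj₂ (inj₂ adj)

  Block : ℕ → ℕ → Set
  Block k = Within (a + offset g k) (g k)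

  block? : ∀ k w → Dec (Block k w)
  block? k w = (a + offset g k ≤? w) ×-dec (w <? a + offset g k + g k)

  Region : ℕ → ℕ → Set
  Region k w = w < a ⊎ Block k w

  block-vertex : ∀ k {o} → o < g k → Block k (a + offset g k + o)
  block-vertex k = within-+ (a + offset g k)

  block⇒a≤ : ∀ {k w} → Block k w → a ≤ w
  block⇒a≤ = proj₁ ∘ within-shiftʳ

  block⇒blockOf : ∀ {k w} → k < m → Block k w → blockOf (applyUpTo g m) (w ∸ a) ≡ just k
  block⇒blockOf k<m w∈k = inBlock⇒blockOf g k<m (proj₂ (within-shiftʳ w∈k))

  blockOf⇒block : ∀ {k w} → a ≤ w → blockOf (applyUpTo g m) (w ∸ a) ≡ just k → k < m × Block k w
  blockOf⇒block a≤w eq with blockOf⇒inBlock g eq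
  ... | k<m , w∈k = k<m , within-shiftˡ a≤w w∈k

  region-adjacent : ∀ {k x y} → k < m → Region k x → Region k y → x ≢ y → Adjacent x y
  region-adjacent k<m (inj₁ x<a) _ x≢y = adjacent-intro x≢y (inj₁ x<a)
  region-adjacent k<m (inj₂ _) (inj₁ y<a) x≢y = adjacent-intro x≢y (inj₂ (inj₁ y<a))
  region-adjacent {k} k<m (inj₂ x∈k) (inj₂ y∈k) x≢y = adjacent-intro x≢y (inj₂ (inj₂
    (subst₂ (λ u v → sameBlock u v ≡ true)
      (sym (block⇒blockOf k<m x∈k)) (sym (block⇒blockOf k<m y∈k)) (sameBlock-just k))))

  neighbour-of-block : ∀ {k x y} → k < m → Block k y → Adjacent x y → Region k x
  neighbour-of-block {k} {x} {y} k<m y∈k adj with x <? a | adjacent-elim adj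
  ... | yes x<a | _ = inj₁ x<a
  ... | no  x≮a | _ , inj₁ x<a = contradiction x<a x≮a
  ... | no  _   | _ , inj₂ (inj₁ y<a) = contradiction y<a (≤⇒≯ (block⇒a≤ y∈k))
  ... | no  x≮a | _ , inj₂ (inj₂ same) with sameBlock≡true⇒≡just same
  ... | c , bx , by with trans (sym by) (block⇒blockOf k<m y∈k)
  ... | refl = inj₂ (proj₂ (blockOf⇒block (≮⇒≥ x≮a) bx))

  neighbour-of-unblocked : ∀ {x y} → a ≤ y → blockOf (applyUpTo g m) (y ∸ a) ≡ nothing →
                           Adjacent x y → x < a
  neighbour-of-unblocked {x} a≤y none adj with adjacent-elim adj
  ... | _ , inj₁ x<a = x<a
  ... | _ , inj₂ (inj₁ y<a) = contradiction y<a (≤⇒≯ a≤y)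
  ... | _ , inj₂ (inj₂ same) with sameBlock≡true⇒≡just {blockOf (applyUpTo g m) (x ∸ a)} same
  ... | _ , _ , by with trans (sym none) by
  ... | ()

  IsClique : ℕ → (ℕ → ℕ) → Set
  IsClique q h = ∀ {r r′} → r < q → r′ < q → r ≢ r′ → Adjacent (h r) (h r′)

  region-bound : ∀ {k q} (h : ℕ → ℕ) → InjectiveOn q h →
                 (∀ {r} → r < q → Region k (h r)) → q ≤ a + g k
  region-bound h h-inj h-into = injectiveOn-two-intervals⇒≤ h h-into h-inj

  clique-in-region : ∀ {q} (h : ℕ → ℕ) → a + 1 < q → InjectiveOn q h → IsClique q h →
                     ∃[ k ] k < m × (∀ {r} → r < q → Region k (h r))
  clique-in-region {q} h a+1<q h-inj clique with anyUpTo? (λ r → a ≤? h r) q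
  ... | no none = contradiction (≤-trans (injectiveOn⇒≤ h below-a h-inj) (m≤m+n a 1)) (<⇒≱ a+1<q)
    where
    below-a : ∀ {r} → r < q → h r < a
    below-a {r} r<q = ≰⇒> (λ a≤hr → none (r , r<q , a≤hr))
  ... | yes (r₀ , r₀<q , a≤hr₀) with blockOf (applyUpTo g m) (h r₀ ∸ a) in b
  ...   | nothing = contradiction (injectiveOn-two-intervals⇒≤ h into h-inj) (<⇒≱ a+1<q)
    where
    into : ∀ {r} → r < q → h r < a ⊎ Within (h r₀) 1 (h r)
    into {r} r<q with r ≟ r₀
    ... | yes refl = inj₂ (≤-refl , m<m+n (h r) z<s)
    ... | no  r≢r₀ = inj₁ (neighbour-of-unblocked a≤hr₀ b (clique r<q r₀<q r≢r₀))
  ...   | just k with blockOf⇒block a≤hr₀ b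
  ...     | k<m , hr₀∈k = k , k<m , into
    where
    into : ∀ {r} → r < q → Region k (h r)
    into {r} r<q with r ≟ r₀
    ... | yes refl = inj₂ hr₀∈k
    ... | no  r≢r₀ = neighbour-of-block k<m hr₀∈k (clique r<q r₀<q r≢r₀)

  regionLabel : (ℕ → ℕ) → (ℕ → ℕ → ℕ) → ℕ → ℕ
  regionLabel ℓU ℓB w with w <? a | blockOf (applyUpTo g m) (w ∸ a)
  ... | yes _ | _       = ℓU w
  ... | no  _ | just k  = ℓB k (w ∸ (a + offset g k))
  ... | no  _ | nothing = 0

  regionLabel-universal : ∀ ℓU ℓB {w} → w < a → regionLabel ℓU ℓB w ≡ ℓU w
  regionLabel-universal ℓU ℓB {w} w<a with w <? a
  ... | yes _   = refl
  ... | no  w≮a = contradiction w<a w≮a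

  regionLabel-block : ∀ ℓU ℓB {k w} → k < m → Block k w →
                      regionLabel ℓU ℓB w ≡ ℓB k (w ∸ (a + offset g k))
  regionLabel-block ℓU ℓB {k} {w} k<m w∈k
    with w <? a | blockOf (applyUpTo g m) (w ∸ a) | block⇒blockOf k<m w∈k
  ... | yes w<a | _ | _    = contradiction w<a (≤⇒≯ (block⇒a≤ w∈k))
  ... | no  _   | _ | refl = refl

  regionLabel-unblocked : ∀ ℓU ℓB {w} → a ≤ w → blockOf (applyUpTo g m) (w ∸ a) ≡ nothing →
                          regionLabel ℓU ℓB w ≡ 0
  regionLabel-unblocked ℓU ℓB {w} a≤w none with w <? a | blockOf (applyUpTo g m) (w ∸ a) | none
  ... | yes w<a | _ | _    = contradiction w<a (≤⇒≯ a≤w)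
  ... | no  _   | _ | refl = refl

  record Segment : Set where
    constructor segment
    field
      uStart uCount host hStart : ℕ

  place : Segment → ℕ → ℕ
  place (segment u₀ uc k h₀) r with r <? uc
  ... | yes _ = u₀ + r
  ... | no  _ = a + offset g k + (h₀ + (r ∸ uc))

  Fits : Segment → ℕ → Set
  Fits (segment u₀ uc k h₀) q = u₀ + uc ≤ a × h₀ + (q ∸ uc) ≤ g k × k < m

  private
    block-part< : ∀ {uc h₀ q r L} → h₀ + (q ∸ uc) ≤ L → r < q → r ≮ uc → h₀ + (r ∸ uc) < L
    block-part< h-fits r<q r≮uc = <-≤-trans (+-monoʳ-< _ (∸-monoˡ-< r<q (≮⇒≥ r≮uc))) h-fits

  place-region : ∀ σ {q r} → Fits σ q → r < q → Region (Segment.host σ) (place σ r)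
  place-region (segment u₀ uc k h₀) {r = r} (u-fits , h-fits , _) r<q with r <? uc
  ... | yes r<uc = inj₁ (<-≤-trans (+-monoʳ-< u₀ r<uc) u-fits)
  ... | no  r≮uc = inj₂ (block-vertex k (block-part< h-fits r<q r≮uc))

  place-injective : ∀ σ {q} → Fits σ q → InjectiveOn q (place σ)
  place-injective (segment u₀ uc k h₀) (u-fits , _) {r} {s} _ _ eq with r <? uc | s <? uc
  ... | yes _    | yes _    = +-cancelˡ-≡ u₀ _ _ eq
  ... | yes r<uc | no  _    = contradiction (subst (a ≤_) (sym eq) (≤-trans (m≤m+n a _) (m≤m+n _ _)))
                                            (<⇒≱ (<-≤-trans (+-monoʳ-< u₀ r<uc) u-fits))
  ... | no  _    | yes s<uc = contradiction (subst (a ≤_) eq (≤-trans (m≤m+n a _) (m≤m+n _ _)))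
                                            (<⇒≱ (<-≤-trans (+-monoʳ-< u₀ s<uc) u-fits))
  ... | no  r≮uc | no  s≮uc =
    ∸-cancelʳ-≡ (≮⇒≥ r≮uc) (≮⇒≥ s≮uc)
      (+-cancelˡ-≡ h₀ _ _ (+-cancelˡ-≡ (a + offset g k) _ _ eq))

  record LabelledFit (ℓU : ℕ → ℕ) (ℓB : ℕ → ℕ → ℕ) (σ : Segment) (q c : ℕ) : Set where
    open Segment σ
    field
      fits    : Fits σ q
      u-label : ∀ {r} → r < uCount → ℓU (uStart + r) ≡ c
      h-label : ∀ {r} → uCount ≤ r → r < q → ℓB host (hStart + (r ∸ uCount)) ≡ c

  place-label : ∀ {ℓU ℓB} σ {q c} → LabelledFit ℓU ℓB σ q c →
                ∀ {r} → r < q → regionLabel ℓU ℓB (place σ r) ≡ c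
  place-label {ℓU} {ℓB} (segment u₀ uc k h₀) labelled {r} r<q with r <? uc | LabelledFit.fits labelled
  ... | yes r<uc | u-fits , _ =
    trans (regionLabel-universal ℓU ℓB (<-≤-trans (+-monoʳ-< u₀ r<uc) u-fits))
          (LabelledFit.u-label labelled r<uc)
  ... | no  r≮uc | _ , h-fits , k<m =
    trans (regionLabel-block ℓU ℓB k<m (block-vertex k (block-part< h-fits r<q r≮uc)))
          (trans (cong (ℓB k) (m+n∸m≡n (a + offset g k) _))
                 (LabelledFit.h-label labelled (≮⇒≥ r≮uc) r<q))

-- The graph H(n; p₁, …, p_t)

module Orders (t : ℕ) (p : ℕ → ℕ) (t≥2 : 2 ≤ t) (p₁≥2 : 2 ≤ p 1)
               (p-mono : ∀ i → 1 ≤ i → suc i ≤ t → p i ≤ p (suc i)) where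

  -- Cliques and blocks are indexed from 0: the c-th clique of F has order P c = p_{c+1},
  -- and the k-th block of H has order Q k = p_{k+2} + 1.
  P : ℕ → ℕ
  P c = p (suc c)

  a : ℕ
  a = p 1 ∸ 2

  Q : ℕ → ℕ
  Q k = suc (P (suc k))

  open Join a Q (t ∸ 1) public

  a+2≡P0 : a + 2 ≡ P 0
  a+2≡P0 = m∸n+n≡m p₁≥2

  P-mono : ∀ {i j} → i ≤ j → j < t → P i ≤ P j
  P-mono = ≤-from-steps P (λ {j} _ 1+j<t → p-mono (suc j) (s≤s z≤n) 1+j<t) z≤n

  a+1<P : ∀ {c} → c < t → a + 1 < P c
  a+1<P c<t = ≤-trans (≤-reflexive (sym (+-suc a 1))) (≤-trans (≤-reflexive a+2≡P0) (P-mono z≤n c<t))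

  overflow : ∀ X → X + P 0 ≰ a + suc X
  overflow X le =
    1+n≰n (≤-trans (≤-reflexive (sym (shape X a))) (subst (λ z → X + z ≤ a + suc X) (sym a+2≡P0) le))
    where
    shape : ∀ x y → x + (y + 2) ≡ suc (y + suc x)
    shape = solve-∀

  <t∸1⇒suc<t : ∀ {k} → k < t ∸ 1 → suc k < t
  <t∸1⇒suc<t {k} k<t∸1 = subst (suc k <_) (m+[n∸m]≡n (≤-trans (s≤s z≤n) t≥2)) (s≤s k<t∸1)

  suc<t⇒<t∸1 : ∀ {k} → suc k < t → k < t ∸ 1
  suc<t⇒<t∸1 1+k<t = ∸-monoˡ-< 1+k<t (s≤s z≤n)

  pList≡ : pList t p ≡ applyUpTo P t
  pList≡ = map-upTo P t

  F : Graph (sum (pList t p))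
  F = unionCliques (pList t p)

  packing⇒F-copy : ∀ {k} {G : Graph k} → CliquePacking G P t → Contains F G
  packing⇒F-copy {G = G} = subst (λ ss → Contains (unionCliques ss) G) (sym pList≡) ∘ packing⇒contains

  F-copy⇒packing : ∀ {k} {G : Graph k} → Contains F G → CliquePacking G P t
  F-copy⇒packing {G = G} = contains⇒packing ∘ subst (λ ss → Contains (unionCliques ss) G) pList≡

  Gaps : Set
  Gaps = ∀ {j} → 1 ≤ j → suc j < t → P (suc j) ≡ P j ⊎ P j + P 0 ≤ P (suc j)

  Condition : Set
  Condition = ∀ i → 2 ≤ i → i ≤ t ∸ 1 → (p 1 ≤ p (suc i) ∸ p i) ⊎ (p (suc i) ≡ p i)

  condition⇒gaps : Condition → Gaps
  condition⇒gaps condition {j} 1≤j 1+j<t with condition (suc j) (s≤s 1≤j) (suc<t⇒<t∸1 1+j<t)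
  ... | inj₁ P0≤ =
    inj₂ (≤-trans (+-monoʳ-≤ (P j) P0≤) (≤-reflexive (m+[n∸m]≡n (P-mono (n≤1+n j) 1+j<t))))
  ... | inj₂ same = inj₁ same

  module _ {n : ℕ} where

    H-adjacency : ∀ u v → H n t p u v ≡ joinAdjacency a (applyUpTo Q (t ∸ 1)) (toℕ u) (toℕ v)
    H-adjacency u v = cong (λ hs → joinAdjacency a hs (toℕ u) (toℕ v)) (map-upTo Q (t ∸ 1))

    H⇒Adjacent : ∀ {x y} .(x<n : x < n) .(y<n : y < n) →
                 H n t p (fromℕ< x<n) (fromℕ< y<n) ≡ true → Adjacent x y
    H⇒Adjacent x<n y<n edge =
      subst₂ Adjacent (toℕ-fromℕ< x<n) (toℕ-fromℕ< y<n) (trans (sym (H-adjacency _ _)) edge)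

    Adjacent⇒H : ∀ {x y} .(x<n : x < n) .(y<n : y < n) →
                 Adjacent x y → H n t p (fromℕ< x<n) (fromℕ< y<n) ≡ true
    Adjacent⇒H x<n y<n adj =
      trans (H-adjacency _ _) (subst₂ Adjacent (sym (toℕ-fromℕ< x<n)) (sym (toℕ-fromℕ< y<n)) adj)

  module PackingInH {n} (packing : CliquePacking (H n t p) P t) where
    open CliquePacking packing

    clique : ∀ {c} → c < t → IsClique (P c) (vertex c)
    clique c<t r<P r′<P r≢r′ = H⇒Adjacent _ _ (vertex-adjacent c<t r<P r′<P r≢r′)

    injective : ∀ {c} → c < t → InjectiveOn (P c) (vertex c)
    injective c<t r<P r′<P eq = proj₂ (vertex-injective c<t c<t r<P r′<P eq)

    host : ℕ → ℕ
    host c with c <? t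
    ... | yes c<t = proj₁ (clique-in-region (vertex c) (a+1<P c<t) (injective c<t) (clique c<t))
    ... | no  _   = 0

    host-spec : ∀ {c} → c < t → host c < t ∸ 1 × (∀ {r} → r < P c → Region (host c) (vertex c r))
    host-spec {c} c<t with c <? t
    ... | yes c<t′ = proj₂ (clique-in-region (vertex c) (a+1<P c<t′) (injective c<t′) (clique c<t′))
    ... | no  c≮t  = contradiction c<t c≮t

    suc-host<t : ∀ {c} → c < t → suc (host c) < t
    suc-host<t c<t = <t∸1⇒suc<t (proj₁ (host-spec c<t))

    P≤P∘suc∘host : Gaps → ∀ {c} → c < t → P c ≤ P (suc (host c))
    P≤P∘suc∘host gaps {zero}      c<t = P-mono z≤n (suc-host<t c<t)
    P≤P∘suc∘host gaps {c@(suc _)} c<t = ≮⇒≥ λ P∘suc∘host<Pc → overflow (P (suc (host c))) (begin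
      P (suc (host c)) + P 0  ≤⟨ gap-from-steps P (P 0) gaps (s≤s z≤n) (s≤s z≤n)
                                   (suc-host<t c<t) c<t P∘suc∘host<Pc ⟩
      P c                     ≤⟨ region-bound (vertex c) (injective c<t) (proj₂ (host-spec c<t)) ⟩
      a + Q (host c)          ∎)
      where open ≤-Reasoning

    shared-host-strict : ∀ {c c′} → c < t → c′ < t → c ≢ c′ → host c ≡ host c′ →
                         P c < P (suc (host c))
    shared-host-strict {c} {c′} c<t c′<t c≢c′ same = ≰⇒> λ P∘suc∘host≤Pc → overflow (P c)
      (begin
        P c + P 0       ≤⟨ +-monoʳ-≤ (P c) (P-mono z≤n c′<t) ⟩
        P c + P c′      ≤⟨ region-bound (append (P c) (vertex c) (vertex c′)) both-injective both-in ⟩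
        a + Q (host c)  ≤⟨ +-monoʳ-≤ a (s≤s P∘suc∘host≤Pc) ⟩
        a + suc (P c)   ∎)
      where
      open ≤-Reasoning
      both-injective = append-injective (injective c<t) (injective c′<t)
                         (λ r<P r′<P eq → c≢c′ (proj₁ (vertex-injective c<t c′<t r<P r′<P eq)))
      both-in = append-all (Region (host c)) (proj₂ (host-spec c<t))
        (subst (λ k → ∀ {r} → r < P c′ → Region k (vertex c′ r)) (sym same) (proj₂ (host-spec c′<t)))

  no-copy : Gaps → ∀ {n} → ¬ Contains F (H n t p)
  no-copy gaps contains = tight-collision P (suc ∘ host) (≤-trans (s≤s z≤n) t≥2)
    (λ c<t → z<s , suc-host<t c<t) (P≤P∘suc∘host gaps)
    (λ c<t c′<t _ c≢c′ same → shared-host-strict c<t c′<t c≢c′ (suc-injective same))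
    where open PackingInH (F-copy⇒packing contains)

  vertex-count : a + offset Q (t ∸ 1) ≡ sum (pList t p) + t ∸ 3
  vertex-count = begin
    a + offset Q τ                              ≡⟨ cong (a +_) (offset-suc (P ∘ suc) τ) ⟩
    a + (S + τ)                                 ≡⟨ m+n∸m≡n 3 _ ⟨
    3 + (a + (S + τ)) ∸ 3                       ≡⟨ cong (_∸ 3) (shape a S τ) ⟩
    a + 2 + S + suc τ ∸ 3                       ≡⟨ cong (λ z → z + S + suc τ ∸ 3) a+2≡P0 ⟩
    offset P (suc τ) + suc τ ∸ 3                ≡⟨ cong (λ z → offset P z + z ∸ 3) suc[t∸1]≡t ⟩
    offset P t + t ∸ 3                          ≡⟨ cong (λ ss → sum ss + t ∸ 3) pList≡ ⟨
    sum (pList t p) + t ∸ 3                     ∎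
    where
    open ≡-Reasoning
    τ = t ∸ 1
    S = offset (P ∘ suc) τ
    suc[t∸1]≡t : suc τ ≡ t
    suc[t∸1]≡t = m+[n∸m]≡n (≤-trans (s≤s z≤n) t≥2)
    shape : ∀ x y z → 3 + (x + (y + z)) ≡ x + 2 + y + suc z
    shape = solve-∀

  module Embeddings {n} (n-large : sum (pList t p) + t ∸ 3 ≤ n) where

    H-fits : a + offset Q (t ∸ 1) ≤ n
    H-fits = subst (_≤ n) (sym vertex-count) n-large

    region< : ∀ {k w} → k < t ∸ 1 → Region k w → w < n
    region< _   (inj₁ w<a)     = <-≤-trans w<a (≤-trans (m≤m+n a _) H-fits)
    region< {k} k<m (inj₂ (_ , hi)) = <-≤-trans hi (begin
      a + offset Q k + Q k     ≡⟨ +-assoc a _ _ ⟩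
      a + (offset Q k + Q k)   ≤⟨ +-monoʳ-≤ a (offset+size≤offset Q k<m) ⟩
      a + offset Q (t ∸ 1)     ≤⟨ H-fits ⟩
      n                        ∎)
      where open ≤-Reasoning

    segment-packing : (σ : ℕ → Segment) (ℓU : ℕ → ℕ) (ℓB : ℕ → ℕ → ℕ) →
                      (∀ {c} → c < t → LabelledFit ℓU ℓB (σ c) (P c) c) → CliquePacking (H n t p) P t
    segment-packing σ ℓU ℓB labelled = record
      { vertex           = vertex
      ; vertex<          = λ c<t r<P → region< (host< c<t) (in-region c<t r<P)
      ; vertex-injective = labelled-injective vertex (regionLabel ℓU ℓB)
                             (λ c<t → place-label (σ _) (labelled c<t)) injective
      ; vertex-adjacent  = λ c<t r<P r′<P r≢r′ → Adjacent⇒H _ _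
                             (region-adjacent (host< c<t) (in-region c<t r<P) (in-region c<t r′<P)
                                              (r≢r′ ∘ injective c<t r<P r′<P))
      }
      where
      vertex : ℕ → ℕ → ℕ
      vertex c = place (σ c)
      fits : ∀ {c} → c < t → Fits (σ c) (P c)
      fits c<t = LabelledFit.fits (labelled c<t)
      host< : ∀ {c} → c < t → Segment.host (σ c) < t ∸ 1
      host< c<t = proj₂ (proj₂ (fits c<t))
      in-region : ∀ {c r} → c < t → r < P c → Region (Segment.host (σ c)) (vertex c r)
      in-region c<t = place-region (σ _) (fits c<t)
      injective : ∀ {c} → c < t → InjectiveOn (P c) (vertex c)
      injective c<t = place-injective (σ _) (fits c<t)

    module Violation {l} (l+2<t : suc (suc l) < t) (increase : P (suc l) < P (suc (suc l)))
                     (small-increase : P (suc (suc l)) < P (suc l) + P 0) where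

      u : ℕ
      u = P (suc (suc l)) ∸ P (suc l) ∸ 1

      P[l+2]≡ : P (suc l) + suc u ≡ P (suc (suc l))
      P[l+2]≡ =
        trans (cong (P (suc l) +_) (m+[n∸m]≡n (m<n⇒0<n∸m increase))) (m+[n∸m]≡n (<⇒≤ increase))

      u+2≤P0 : u + 2 ≤ P 0
      u+2≤P0 = +-cancelˡ-≤ (P (suc l)) _ _ (begin
        P (suc l) + (u + 2)     ≡⟨ cong (P (suc l) +_) (+-comm u 2) ⟩
        P (suc l) + suc (suc u) ≡⟨ +-suc _ _ ⟩
        suc (P (suc l) + suc u) ≡⟨ cong suc P[l+2]≡ ⟩
        suc (P (suc (suc l)))   ≤⟨ small-increase ⟩
        P (suc l) + P 0         ∎)
        where open ≤-Reasoning

      u≤a : u ≤ a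
      u≤a = +-cancelʳ-≤ 2 u a (≤-trans u+2≤P0 (≤-reflexive (sym a+2≡P0)))

      P0∸[a∸u]≡u+2 : P 0 ∸ (a ∸ u) ≡ u + 2
      P0∸[a∸u]≡u+2 = begin
        P 0 ∸ (a ∸ u)             ≡⟨ cong (_∸ (a ∸ u)) a+2≡P0 ⟨
        a + 2 ∸ (a ∸ u)           ≡⟨ cong (λ z → z + 2 ∸ (a ∸ u)) (m∸n+n≡m u≤a) ⟨
        a ∸ u + u + 2 ∸ (a ∸ u)   ≡⟨ cong (_∸ (a ∸ u)) (+-assoc (a ∸ u) u 2) ⟩
        a ∸ u + (u + 2) ∸ (a ∸ u) ≡⟨ m+n∸m≡n (a ∸ u) _ ⟩
        u + 2                     ∎
        where open ≡-Reasoning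

      l+1<t∸1 : suc l < t ∸ 1
      l+1<t∸1 = suc<t⇒<t∸1 l+2<t

      -- Cliques l+1 and l+2 swap blocks, clique l+2 also taking the first u universal vertices;
      -- clique 0 takes the other a ∸ u universal vertices and the first u + 2 vertices of block l+1.
      segmentOf : ℕ → Segment
      segmentOf zero = segment u (a ∸ u) (suc l) 0
      segmentOf (suc k) with k ≟ l | k ≟ suc l
      ... | yes _ | _     = segment 0 0 (suc l) (u + 2)
      ... | no  _ | yes _ = segment 0 u l 0
      ... | no  _ | no  _ = segment 0 0 k 0

      universalLabel : ℕ → ℕ
      universalLabel = cutoff u (suc (suc l)) 0

      sharedBlockLabel : ℕ → ℕ
      sharedBlockLabel = cutoff (u + 2) 0 (suc l)

      blockLabel : ℕ → ℕ → ℕ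
      blockLabel k o with k ≟ suc l | k ≟ l
      ... | yes _ | _     = sharedBlockLabel o
      ... | no  _ | yes _ = suc (suc l)
      ... | no  _ | no  _ = suc k

      blockLabel-shared : ∀ o → blockLabel (suc l) o ≡ sharedBlockLabel o
      blockLabel-shared o with suc l ≟ suc l
      ... | yes _ = refl
      ... | no  ≢ = contradiction refl ≢

      blockLabel-swapped : ∀ o → blockLabel l o ≡ suc (suc l)
      blockLabel-swapped o with l ≟ suc l | l ≟ l
      ... | yes l≡1+l | _   = contradiction (sym l≡1+l) 1+n≢n
      ... | no  _     | yes _ = refl
      ... | no  _     | no  ≢ = contradiction refl ≢

      blockLabel-other : ∀ {k} o → k ≢ suc l → k ≢ l → blockLabel k o ≡ suc k
      blockLabel-other {k} o k≢1+l k≢l with k ≟ suc l | k ≟ l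
      ... | yes k≡1+l | _       = contradiction k≡1+l k≢1+l
      ... | no  _     | yes k≡l = contradiction k≡l k≢l
      ... | no  _     | no  _   = refl

      labelled-fit : ∀ {c} → c < t → LabelledFit universalLabel blockLabel (segmentOf c) (P c) c
      labelled-fit {zero} _ = record
        { fits    = ≤-reflexive (m+[n∸m]≡n u≤a)
                  , ≤-trans (≤-reflexive P0∸[a∸u]≡u+2) u+2≤Q[l+1]
                  , l+1<t∸1
        ; u-label = λ _ → cutoff-≥ (m≤m+n u _)
        ; h-label = λ {r} a∸u≤r r<P0 → trans (blockLabel-shared _)
                      (cutoff-< (subst (r ∸ (a ∸ u) <_) P0∸[a∸u]≡u+2 (∸-monoˡ-< r<P0 a∸u≤r)))
        }
        where
        u+2≤Q[l+1] : u + 2 ≤ Q (suc l)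
        u+2≤Q[l+1] = ≤-trans (≤-reflexive (+-comm u 2))
                       (s≤s (≤-trans (m≤n+m (suc u) (P (suc l))) (≤-reflexive P[l+2]≡)))
      labelled-fit {suc k} 1+k<t with k ≟ l | k ≟ suc l
      ... | yes refl | _ = record
        { fits    = z≤n , ≤-reflexive (trans (shape u (P (suc l))) (cong suc P[l+2]≡)) , l+1<t∸1
        ; u-label = λ ()
        ; h-label = λ _ _ → trans (blockLabel-shared _) (cutoff-≥ (m≤m+n (u + 2) _))
        }
        where
        shape : ∀ x y → x + 2 + y ≡ suc (y + suc x)
        shape = solve-∀
      ... | no _ | yes refl = record
        { fits    = u≤a , ≤-reflexive P[l+2]∸u≡ , suc<t⇒<t∸1 (<-trans (n<1+n _) l+2<t)
        ; u-label = cutoff-<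
        ; h-label = λ _ _ → blockLabel-swapped _
        }
        where
        P[l+2]∸u≡ : P (suc (suc l)) ∸ u ≡ Q l
        P[l+2]∸u≡ = trans (cong (_∸ u) (trans (sym P[l+2]≡) (+-suc _ u))) (m+n∸n≡m _ u)
      ... | no k≢l | no k≢1+l = record
        { fits    = z≤n , n≤1+n _ , suc<t⇒<t∸1 1+k<t
        ; u-label = λ ()
        ; h-label = λ _ _ → blockLabel-other _ k≢1+l k≢l
        }

      copy : Contains F (H n t p)
      copy = packing⇒F-copy (segment-packing segmentOf universalLabel blockLabel labelled-fit)

    module AddedEdge (U V : Fin n) (U≢V : U ≢ V) (non-edge : H n t p U V ≡ false) where

      H⁺ : Graph n
      H⁺ = addEdge (H n t p) U V

      x y : ℕ
      x = toℕ U
      y = toℕ V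

      x≢y : x ≢ y
      x≢y = U≢V ∘ toℕ-injective

      non-adjacent : ¬ Adjacent x y
      non-adjacent adj with () ← trans (sym non-edge) (trans (H-adjacency U V) adj)

      a≤x : a ≤ x
      a≤x = ≮⇒≥ (λ x<a → non-adjacent (adjacent-intro x≢y (inj₁ x<a)))

      a≤y : a ≤ y
      a≤y = ≮⇒≥ (λ y<a → non-adjacent (adjacent-intro x≢y (inj₂ (inj₁ y<a))))

      -- The position in block k left out by clique k+1: that of x or of y if one of them lies in
      -- block k (they cannot both), and an irrelevant junk position otherwise.
      hole : ℕ → ℕ
      hole k with block? k x
      ... | yes _ = x ∸ (a + offset Q k)
      ... | no  _ = y ∸ (a + offset Q k)

      hole-endpoint : ∀ {k w} → k < t ∸ 1 → Block k w → w ≡ x ⊎ w ≡ y →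
                      w ∸ (a + offset Q k) ≡ hole k
      hole-endpoint {k} k<m w∈k w≡ with block? k x | w≡
      ... | yes _   | inj₁ refl = refl
      ... | yes x∈k | inj₂ refl =
        contradiction (region-adjacent k<m (inj₂ x∈k) (inj₂ w∈k) x≢y) non-adjacent
      ... | no  x∉k | inj₁ refl = contradiction w∈k x∉k
      ... | no  _   | inj₂ refl = refl

      data Slot : ℕ → Set where
        universal : ∀ {r} → r < a → Slot r
        first     : Slot a
        second    : Slot (suc a)

      slot : ∀ {r} → r < P 0 → Slot r
      slot {r} r<P0 with r <? a | r ≟ a
      ... | yes r<a | _        = universal r<a
      ... | no  _   | yes refl = first
      ... | no  r≮a | no  r≢a  =
        subst Slot (≤-antisym (≤∧≢⇒< (≮⇒≥ r≮a) (r≢a ∘ sym)) (s≤s⁻¹ r<a+2)) second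
        where
        r<a+2 : r < suc (suc a)
        r<a+2 = <-≤-trans r<P0 (≤-reflexive (trans (sym a+2≡P0) (+-comm a 2)))

      slotVertex : ∀ {r} → Slot r → ℕ
      slotVertex (universal {r} _) = r
      slotVertex first             = x
      slotVertex second            = y

      vertex : ℕ → ℕ → ℕ
      vertex zero    r = cutoff a r (cutoff (suc a) x y r) r
      vertex (suc k) r = a + offset Q k + avoid (hole k) (P (suc k)) r

      vertex₀≡slotVertex : ∀ {r} (σ : Slot r) → vertex 0 r ≡ slotVertex σ
      vertex₀≡slotVertex (universal r<a) = cutoff-< r<a
      vertex₀≡slotVertex first           = trans (cutoff-≥ {a} ≤-refl) (cutoff-< {suc a} (n<1+n a))
      vertex₀≡slotVertex second          = trans (cutoff-≥ {a} (n≤1+n a)) (cutoff-≥ {suc a} ≤-refl)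

      blocked-vertex : ∀ {k r} → r < P (suc k) → Block k (vertex (suc k) r)
      blocked-vertex {k} r<P = block-vertex k (s≤s (avoid≤ r<P))

      blockLabel : ℕ → ℕ → ℕ
      blockLabel k o with o ≟ hole k
      ... | yes _ = 0
      ... | no  _ = suc k

      blockLabel-hole : ∀ {k o} → o ≡ hole k → blockLabel k o ≡ 0
      blockLabel-hole {k} {o} o≡hole with o ≟ hole k
      ... | yes _ = refl
      ... | no  o≢hole = contradiction o≡hole o≢hole

      blockLabel-off-hole : ∀ {k o} → o ≢ hole k → blockLabel k o ≡ suc k
      blockLabel-off-hole {k} {o} o≢hole with o ≟ hole k
      ... | yes o≡hole = contradiction o≡hole o≢hole
      ... | no  _ = refl

      label : ℕ → ℕ
      label = regionLabel (λ _ → 0) blockLabel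

      a≤endpoint : ∀ {w} → w ≡ x ⊎ w ≡ y → a ≤ w
      a≤endpoint (inj₁ refl) = a≤x
      a≤endpoint (inj₂ refl) = a≤y

      label-endpoint : ∀ {w} → w ≡ x ⊎ w ≡ y → label w ≡ 0
      label-endpoint {w} w≡ = by-block (blockOf (applyUpTo Q (t ∸ 1)) (w ∸ a)) refl
        where
        by-block : ∀ β → blockOf (applyUpTo Q (t ∸ 1)) (w ∸ a) ≡ β → label w ≡ 0
        by-block nothing  b = regionLabel-unblocked _ _ (a≤endpoint w≡) b
        by-block (just k) b with blockOf⇒block (a≤endpoint w≡) b
        ... | k<m , w∈k = trans (regionLabel-block _ _ k<m w∈k) (blockLabel-hole (hole-endpoint k<m w∈k w≡))

      label-vertex : ∀ {c r} → c < t → r < P c → label (vertex c r) ≡ c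
      label-vertex {zero} _ r<P0 = trans (cong label (vertex₀≡slotVertex (slot r<P0))) (label-slot (slot r<P0))
        where
        label-slot : ∀ {r} (σ : Slot r) → label (slotVertex σ) ≡ 0
        label-slot (universal r<a) = regionLabel-universal _ _ r<a
        label-slot first           = label-endpoint (inj₁ refl)
        label-slot second          = label-endpoint (inj₂ refl)
      label-vertex {suc k} {r} c<t r<P =
        trans (regionLabel-block _ _ (suc<t⇒<t∸1 c<t) (blocked-vertex r<P))
              (trans (cong (blockLabel k) (m+n∸m≡n (a + offset Q k) _)) (blockLabel-off-hole (avoid≢ r<P)))

      slotVertex-injective : ∀ {r s} (σ : Slot r) (τ : Slot s) → slotVertex σ ≡ slotVertex τ → r ≡ s
      slotVertex-injective (universal _)   (universal _)   eq = eq
      slotVertex-injective (universal r<a) first           eq = contradiction r<a (≤⇒≯ (subst (a ≤_) (sym eq) a≤x))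
      slotVertex-injective (universal r<a) second          eq = contradiction r<a (≤⇒≯ (subst (a ≤_) (sym eq) a≤y))
      slotVertex-injective first           (universal s<a) eq = contradiction s<a (≤⇒≯ (subst (a ≤_) eq a≤x))
      slotVertex-injective first           first           _  = refl
      slotVertex-injective first           second          eq = contradiction eq x≢y
      slotVertex-injective second          (universal s<a) eq = contradiction s<a (≤⇒≯ (subst (a ≤_) eq a≤y))
      slotVertex-injective second          first           eq = contradiction (sym eq) x≢y
      slotVertex-injective second          second          _  = refl

      slotVertex< : ∀ {r} (σ : Slot r) → slotVertex σ < n
      slotVertex< (universal r<a) = <-≤-trans r<a (≤-trans (m≤m+n a _) H-fits)
      slotVertex< first           = toℕ<n U
      slotVertex< second          = toℕ<n V

      old-edge : ∀ {r s} (σ : Slot r) (τ : Slot s) → r ≢ s → slotVertex σ < a ⊎ slotVertex τ < a →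
                 H⁺ (fromℕ< (slotVertex< σ)) (fromℕ< (slotVertex< τ)) ≡ true
      old-edge σ τ r≢s below = addEdge-⊇ (H n t p) U V (Adjacent⇒H (slotVertex< σ) (slotVertex< τ)
        (adjacent-intro (r≢s ∘ slotVertex-injective σ τ) (Sum.map₂ inj₁ below)))

      slot-adjacent : ∀ {r s} (σ : Slot r) (τ : Slot s) → r ≢ s →
                      H⁺ (fromℕ< (slotVertex< σ)) (fromℕ< (slotVertex< τ)) ≡ true
      slot-adjacent σ@(universal r<a) τ                 r≢s = old-edge σ τ r≢s (inj₁ r<a)
      slot-adjacent first             τ@(universal s<a) r≢s = old-edge first τ r≢s (inj₂ s<a)
      slot-adjacent second            τ@(universal s<a) r≢s = old-edge second τ r≢s (inj₂ s<a)
      slot-adjacent first             first             r≢s = contradiction refl r≢s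
      slot-adjacent second            second            r≢s = contradiction refl r≢s
      slot-adjacent first             second            _   =
        subst₂ (λ i j → H⁺ i j ≡ true) (sym (fromℕ<-toℕ U (toℕ<n U))) (sym (fromℕ<-toℕ V (toℕ<n V)))
          (addEdge-new (H n t p) U V)
      slot-adjacent second            first             _   =
        subst₂ (λ i j → H⁺ i j ≡ true) (sym (fromℕ<-toℕ V (toℕ<n V))) (sym (fromℕ<-toℕ U (toℕ<n U)))
          (addEdge-new′ (H n t p) U V)

      vertex< : ∀ {c r} → c < t → r < P c → vertex c r < n
      vertex< {zero}  _   r<P0 =
        subst (_< n) (sym (vertex₀≡slotVertex (slot r<P0))) (slotVertex< (slot r<P0))
      vertex< {suc k} c<t r<P  = region< (suc<t⇒<t∸1 c<t) (inj₂ (blocked-vertex r<P))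

      injective : ∀ {c} → c < t → InjectiveOn (P c) (vertex c)
      injective {zero}  _ r<P0 s<P0 eq = slotVertex-injective (slot r<P0) (slot s<P0)
        (trans (sym (vertex₀≡slotVertex (slot r<P0))) (trans eq (vertex₀≡slotVertex (slot s<P0))))
      injective {suc k} _ r<P s<P eq = avoid-injective r<P s<P (+-cancelˡ-≡ (a + offset Q k) _ _ eq)

      adjacent : ∀ {c r r′} (c<t : c < t) (r<P : r < P c) (r′<P : r′ < P c) → r ≢ r′ →
                 H⁺ (fromℕ< (vertex< c<t r<P)) (fromℕ< (vertex< c<t r′<P)) ≡ true
      adjacent {zero} c<t r<P0 r′<P0 r≢r′ =
        subst₂ (λ i j → H⁺ i j ≡ true) (as-slot r<P0) (as-slot r′<P0)
          (slot-adjacent (slot r<P0) (slot r′<P0) r≢r′)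
        where
        as-slot : ∀ {r} (r<P0 : r < P 0) → fromℕ< (slotVertex< (slot r<P0)) ≡ fromℕ< (vertex< c<t r<P0)
        as-slot r<P0 =
          fromℕ<-cong _ _ (sym (vertex₀≡slotVertex (slot r<P0))) (slotVertex< (slot r<P0)) (vertex< c<t r<P0)
      adjacent {suc k} c<t r<P r′<P r≢r′ = addEdge-⊇ (H n t p) U V
        (Adjacent⇒H (vertex< c<t r<P) (vertex< c<t r′<P)
          (region-adjacent (suc<t⇒<t∸1 c<t) (inj₂ (blocked-vertex r<P)) (inj₂ (blocked-vertex r′<P))
            (r≢r′ ∘ injective c<t r<P r′<P)))

      packing : CliquePacking H⁺ P t
      packing = record
        { vertex           = vertex
        ; vertex<          = vertex<
        ; vertex-injective = labelled-injective vertex label label-vertex injective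
        ; vertex-adjacent  = adjacent
        }

      copy : Contains F H⁺
      copy = packing⇒F-copy packing

theorem1p1 : (t : ℕ) → 2 ≤ t → (p : ℕ → ℕ) →
    2 ≤ p 1 →
    (∀ i → 1 ≤ i → suc i ≤ t → p i ≤ p (suc i)) →
    (n : ℕ) → sum (pList t p) + t ∸ 3 ≤ n →
    (Saturated (unionCliques (pList t p)) (H n t p) ⇔
      (∀ i → 2 ≤ i → i ≤ t ∸ 1 →
        (p 1 ≤ p (suc i) ∸ p i) ⊎ (p (suc i) ≡ p i)))
theorem1p1 t t≥2 p p₁≥2 p-mono n n-large = mk⇔ necessary sufficient
  where
  open Orders t p t≥2 p₁≥2 p-mono
  open Embeddings n-large

  sufficient : Condition → Saturated F (H n t p)
  sufficient condition = no-copy (condition⇒gaps condition) , AddedEdge.copy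

  necessary : Saturated F (H n t p) → Condition
  necessary _ 0 () _
  necessary _ 1 (s≤s ()) _
  necessary (F-free , _) i@(suc (suc l)) _ i≤t∸1 with p (suc i) ≟ p i | p 1 ≤? p (suc i) ∸ p i
  ... | yes same   | _        = inj₂ same
  ... | _          | yes jump = inj₁ jump
  ... | no  differ | no small = contradiction (Violation.copy l+2<t increase small-increase) F-free
    where
    l+2<t : suc (suc l) < t
    l+2<t = <t∸1⇒suc<t i≤t∸1
    increase : P (suc l) < P (suc (suc l))
    increase = ≤∧≢⇒< (P-mono (n≤1+n _) l+2<t) (differ ∘ sym)
    small-increase : P (suc (suc l)) < P (suc l) + P 0
    small-increase =
      subst (_< P (suc l) + P 0) (m+[n∸m]≡n (<⇒≤ increase)) (+-monoʳ-< (P (suc l)) (≰⇒> small))
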